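{- Let $\alpha,\gamma\ge 0$ be integers, let $\beta,k,\ell$ be positive integers, and let $n\ge k\ell$. Then $$S^{\gamma,\alpha,\beta}_{n+1,k,\ell}=\gamma\,S^{\gamma,\alpha,\beta}_{n,k,\ell}+\sum_{i=0}^{n}\binom{n}{i}S^{\gamma,\alpha,\beta}_{i,k-1,\ell}\,S^{0,\alpha,\beta}_{n-i+1,1,\ell}.$$
   Context: Degenerate falling factorial: $(t)_{m,\lambda}=t(t-\lambda)\cdots(t-(m-1)\lambda)$, $(t)_{0,\lambda}=1$. For integers $m,k\ge0$, $S^{\gamma,\alpha,\beta}_{m,k,\ell}$ is the sum over all pairs $(G,P)$, where $G\subseteq\{1,\dots,m\}$ is possibly empty and $P$ is a set partition of $\{1,\dots,m\}\setminus G$ into exactly $k$ non-empty blocks, of the weight $\gamma^{|G|}\prod_{B\in P}w(B)$ with $w(B)=(\beta-\alpha)_{|B|-1,\alpha}$ if $|B|\le\ell$ and $w(B)=1$ if $|B|>\ell$, using $0^0=1$. In particular $S^{0,\alpha,\beta}_{m,1,\ell}$ equals $(\beta-\alpha)_{m-1,\alpha}$ if $1\le m\le\ell$ and $1$ if $m>\ell$. -}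

module Defs where

open import Data.Nat as ℕ using (ℕ; zero; suc; _≤?_)
open import Data.Integer as ℤ using (ℤ; +_; _-_; _*_; _+_; _^_)
open import Data.List using (List; []; _∷_; map; foldr; concatMap; length; filterᵇ; upTo)
open import Data.Product using (_×_; _,_; proj₁; proj₂)
open import Data.Bool using (Bool; if_then_else_)
open import Relation.Nullary.Decidable using (⌊_⌋; yes; no)

sumℤ : List ℤ → ℤ
sumℤ = foldr _+_ (+ 0)

prodℤ : List ℤ → ℤ
prodℤ = foldr _*_ (+ 1)

-- degenerate falling factorial (t)_{m,λ} = t (t - λ) ... (t - (m-1) λ), (t)_{0,λ} = 1
dff : ℤ → ℕ → ℤ → ℤ
dff t zero    lam = + 1
dff t (suc m) lam = dff t m lam * (t - (+ m) * lam)

-- A pair (G , P): G ⊆ {1..m} a list of elements, P a list of blocks (lists of elements).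
Config : Set
Config = List ℕ × List (List ℕ)

insertEach : ℕ → List (List ℕ) → List (List (List ℕ))
insertEach x []       = []
insertEach x (b ∷ bs) = ((x ∷ b) ∷ bs) ∷ map (b ∷_) (insertEach x bs)

-- all pairs (G , P) with G ⊆ {1..m} and P a set partition of {1..m} \ G
-- (any number of blocks); element m is put into G, into a new singleton
-- block, or into one of the existing blocks. Each pair occurs exactly once.
configs : ℕ → List Config
configs zero    = ([] , []) ∷ []
configs (suc m) = concatMap step (configs m)
  where
  x = suc m
  step : Config → List Config
  step (G , P) = (x ∷ G , P) ∷ (G , (x ∷ []) ∷ P) ∷ map (G ,_) (insertEach x P)

blockWeight : ℤ → ℤ → ℕ → List ℕ → ℤ
blockWeight α β ℓ B with length B ℕ.≤? ℓ
... | yes _ = dff (β - α) (length B ℕ.∸ 1) α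
... | no  _ = + 1

weight : ℤ → ℤ → ℤ → ℕ → Config → ℤ
weight γ α β ℓ (G , P) = (γ ^ length G) * prodℤ (map (blockWeight α β ℓ) P)

S : ℤ → ℤ → ℤ → ℕ → ℕ → ℕ → ℤ
S γ α β m k ℓ =
  sumℤ (map (weight γ α β ℓ)
            (filterᵇ (λ c → ⌊ length (proj₂ c) ℕ.≟ k ⌋) (configs m)))

-- Insert the elements 1, …, m one at a time: each goes into G, opens a new
-- singleton block, or joins an existing block.  The weight of the result depends
-- only on its shape (|G| and the list of block sizes), so S is a sum over shape
-- histories.  In S_{n+1,k} the first element either enters G, giving the factor γ,
-- or opens a block; that block absorbs n − i of the remaining n elements (C(n,i)
-- choices) and contributes S⁰_{n−i+1,1}, while the other i elements form a
-- configuration with k − 1 blocks.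
module Submission where

open import Defs
open import Data.Nat using (ℕ; suc; _≤_; _∸_)
import Data.Nat
open import Relation.Binary.PropositionalEquality using (_≡_)
open import Data.Nat.Combinatorics using (_C_)
open import Data.Integer using (ℤ; +_; _*_; _+_)
open import Data.List using (map; upTo)

open import Algebra.Properties.CommutativeSemigroup as CommutativeSemigroupProperties using ()
open import Data.Bool using (Bool; true; false; if_then_else_)
open import Data.Integer using (_^_; _-_)
import Data.Integer.Properties as ℤₚ
open import Data.List using (List; []; _∷_; _++_; _∷ʳ_; length; concatMap; filterᵇ; applyUpTo)
import Data.List.Properties as Listₚ
open import Data.Nat as ℕ using (zero; _<_; _≟_; _≤?_; s≤s; z≤n)
open import Data.Nat.Combinatorics using (nCk+nC[k+1]≡[n+1]C[k+1]; k>n⇒nCk≡0)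
import Data.Nat.Properties as ℕₚ
open import Data.Product using (_,_; proj₂)
open import Function using (_∘_)
open import Relation.Binary.PropositionalEquality using (refl; sym; trans; cong; cong₂; module ≡-Reasoning)
open import Relation.Nullary.Decidable using (⌊_⌋; yes; no)
open import Relation.Nullary.Negation using (contradiction)

open ≡-Reasoning
module +-Props = CommutativeSemigroupProperties ℤₚ.+-commutativeSemigroup
module *-Props = CommutativeSemigroupProperties ℤₚ.*-commutativeSemigroup

sumℤ-++ : ∀ (xs ys : List ℤ) → sumℤ (xs ++ ys) ≡ sumℤ xs + sumℤ ys
sumℤ-++ []       ys = sym (ℤₚ.+-identityˡ _)
sumℤ-++ (x ∷ xs) ys = trans (cong (_+_ x) (sumℤ-++ xs ys)) (sym (ℤₚ.+-assoc x _ _))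

sumℤ-∷ʳ : ∀ (xs : List ℤ) x → sumℤ (xs ∷ʳ x) ≡ sumℤ xs + x
sumℤ-∷ʳ xs x = trans (sumℤ-++ xs (x ∷ [])) (cong (_+_ (sumℤ xs)) (ℤₚ.+-identityʳ x))

sumℤ-concatMap : ∀ {A B : Set} (F : B → ℤ) (h : A → List B) (H : A → ℤ) →
  (∀ x → sumℤ (map F (h x)) ≡ H x) → ∀ xs → sumℤ (map F (concatMap h xs)) ≡ sumℤ (map H xs)
sumℤ-concatMap F h H eq []       = refl
sumℤ-concatMap F h H eq (x ∷ xs) = begin
  sumℤ (map F (h x ++ concatMap h xs))                ≡⟨ cong sumℤ (Listₚ.map-++ F (h x) _) ⟩
  sumℤ (map F (h x) ++ map F (concatMap h xs))        ≡⟨ sumℤ-++ (map F (h x)) _ ⟩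
  sumℤ (map F (h x)) + sumℤ (map F (concatMap h xs))  ≡⟨ cong₂ _+_ (eq x) (sumℤ-concatMap F h H eq xs) ⟩
  H x + sumℤ (map H xs)                               ∎

sumℤ-filterᵇ : ∀ {A : Set} (p : A → Bool) (w : A → ℤ) xs →
  sumℤ (map w (filterᵇ p xs)) ≡ sumℤ (map (λ x → if p x then w x else + 0) xs)
sumℤ-filterᵇ p w []       = refl
sumℤ-filterᵇ p w (x ∷ xs) with p x
... | true  = cong (_+_ (w x)) (sumℤ-filterᵇ p w xs)
... | false = trans (sumℤ-filterᵇ p w xs) (sym (ℤₚ.+-identityˡ _))

sumℤ-*ˡ : ∀ {A : Set} c (F : A → ℤ) xs → sumℤ (map (λ x → c * F x) xs) ≡ c * sumℤ (map F xs)
sumℤ-*ˡ c F []       = sym (ℤₚ.*-zeroʳ c)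
sumℤ-*ˡ c F (x ∷ xs) =
  trans (cong (_+_ (c * F x)) (sumℤ-*ˡ c F xs)) (sym (ℤₚ.*-distribˡ-+ c (F x) _))

sumℤ-zeros : ∀ {A : Set} (xs : List A) → sumℤ (map (λ _ → + 0) xs) ≡ + 0
sumℤ-zeros []       = refl
sumℤ-zeros (x ∷ xs) = trans (ℤₚ.+-identityˡ _) (sumℤ-zeros xs)

*-if-zero : ∀ x b y → x * (if b then y else + 0) ≡ (if b then x * y else + 0)
*-if-zero x true  y = refl
*-if-zero x false y = ℤₚ.*-zeroʳ x

sumBelow : (ℕ → ℤ) → ℕ → ℤ
sumBelow F zero    = + 0
sumBelow F (suc n) = F 0 + sumBelow (F ∘ suc) n

sumBelow-cong : ∀ {F G : ℕ → ℤ} n → (∀ i → i < n → F i ≡ G i) → sumBelow F n ≡ sumBelow G n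
sumBelow-cong zero    eq = refl
sumBelow-cong (suc n) eq =
  cong₂ _+_ (eq 0 (s≤s z≤n)) (sumBelow-cong n (λ i i<n → eq (suc i) (s≤s i<n)))

sumBelow-+ : ∀ (F G : ℕ → ℤ) n → sumBelow (λ i → F i + G i) n ≡ sumBelow F n + sumBelow G n
sumBelow-+ F G zero    = refl
sumBelow-+ F G (suc n) =
  trans (cong (_+_ (F 0 + G 0)) (sumBelow-+ (F ∘ suc) (G ∘ suc) n)) (+-Props.interchange (F 0) (G 0) _ _)

sumBelow-last : ∀ (F : ℕ → ℤ) n → sumBelow F (suc n) ≡ sumBelow F n + F n
sumBelow-last F zero    = ℤₚ.+-comm (F 0) (+ 0)
sumBelow-last F (suc n) =
  trans (cong (_+_ (F 0)) (sumBelow-last (F ∘ suc) n)) (sym (ℤₚ.+-assoc (F 0) _ _))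

sumℤ-applyUpTo : ∀ (F : ℕ → ℤ) h n → sumℤ (map F (applyUpTo h n)) ≡ sumBelow (F ∘ h) n
sumℤ-applyUpTo F h zero    = refl
sumℤ-applyUpTo F h (suc n) = cong (_+_ (F (h 0))) (sumℤ-applyUpTo F (h ∘ suc) n)

sumℤ-upTo : ∀ (F : ℕ → ℤ) n → sumℤ (map F (upTo n)) ≡ sumBelow F n
sumℤ-upTo F = sumℤ-applyUpTo F (λ i → i)

+-∸-shift : ∀ s {n i} → i < n → s ℕ.+ (n ∸ i) ≡ suc s ℕ.+ (n ∸ suc i)
+-∸-shift s {n} {i} i<n = trans (cong (s ℕ.+_) (ℕₚ.+-∸-assoc 1 i<n)) (ℕₚ.+-suc s (n ∸ suc i))

pascal-term : ∀ n i (x y : ℤ) → + (suc n C suc i) * x * y ≡ + (n C i) * x * y + + (n C suc i) * x * y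
pascal-term n i x y = begin
  + (suc n C suc i) * x * y               ≡⟨ cong (λ c → + c * x * y) (nCk+nC[k+1]≡[n+1]C[k+1] n i) ⟨
  + (n C i ℕ.+ n C suc i) * x * y  ≡⟨ cong (λ c → c * x * y) (ℤₚ.pos-+ (n C i) (n C suc i)) ⟩
  (+ (n C i) + + (n C suc i)) * x * y     ≡⟨ cong (_* y) (ℤₚ.*-distribʳ-+ x (+ (n C i)) (+ (n C suc i))) ⟩
  (+ (n C i) * x + + (n C suc i) * x) * y ≡⟨ ℤₚ.*-distribʳ-+ y (+ (n C i) * x) _ ⟩
  + (n C i) * x * y + + (n C suc i) * x * y ∎

Weight : Set
Weight = ℕ → List ℕ → ℤ

incrementEach : List ℕ → List (List ℕ)
incrementEach []      = []
incrementEach (a ∷ l) = (suc a ∷ l) ∷ map (a ∷_) (incrementEach l)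

-- extend K n g l sums K over the shapes reached from |G| = g and block sizes l by
-- inserting n further elements exactly as configs does.
extend : Weight → ℕ → ℕ → List ℕ → ℤ
extend K zero    g l = K g l
extend K (suc n) g l =
  extend K n (suc g) l + extend K n g (1 ∷ l) + sumℤ (map (extend K n g) (incrementEach l))

insertEach-sizes : ∀ x (P : List (List ℕ)) →
  map (map length) (insertEach x P) ≡ incrementEach (map length P)
insertEach-sizes x []      = refl
insertEach-sizes x (b ∷ P) = cong (_∷_ (suc (length b) ∷ map length P)) (begin
  map (map length) (map (b ∷_) (insertEach x P))      ≡⟨ Listₚ.map-∘ (insertEach x P) ⟨
  map (map length ∘ (b ∷_)) (insertEach x P)          ≡⟨ Listₚ.map-∘ (insertEach x P) ⟩
  map (length b ∷_) (map (map length) (insertEach x P)) ≡⟨ cong (map (length b ∷_)) (insertEach-sizes x P) ⟩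
  map (length b ∷_) (incrementEach (map length P))     ∎)

shapeExtend : Weight → ℕ → Config → ℤ
shapeExtend K m (G , P) = extend K m (length G) (map length P)

shapeExtend-step : ∀ K m x G P →
  sumℤ (map (shapeExtend K m) ((x ∷ G , P) ∷ (G , (x ∷ []) ∷ P) ∷ map (G ,_) (insertEach x P)))
    ≡ shapeExtend K (suc m) (G , P)
shapeExtend-step K m x G P = begin
  a + (b + sumℤ (map (shapeExtend K m) (map (G ,_) (insertEach x P)))) ≡⟨ cong (λ z → a + (b + sumℤ z)) blocks ⟩
  a + (b + sumℤ (map (extend K m g) (incrementEach l)))               ≡⟨ ℤₚ.+-assoc a b _ ⟨
  a + b + sumℤ (map (extend K m g) (incrementEach l))                 ∎
  where
  g : ℕ
  g = length G
  l : List ℕ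
  l = map length P
  a b : ℤ
  a = extend K m (suc g) l
  b = extend K m g (1 ∷ l)
  blocks : map (shapeExtend K m) (map (G ,_) (insertEach x P)) ≡ map (extend K m g) (incrementEach l)
  blocks = begin
    map (shapeExtend K m) (map (G ,_) (insertEach x P))    ≡⟨ Listₚ.map-∘ (insertEach x P) ⟨
    map (extend K m g ∘ map length) (insertEach x P)       ≡⟨ Listₚ.map-∘ (insertEach x P) ⟩
    map (extend K m g) (map (map length) (insertEach x P)) ≡⟨ cong (map (extend K m g)) (insertEach-sizes x P) ⟩
    map (extend K m g) (incrementEach l)                   ∎

sumℤ-configs : ∀ K n m → sumℤ (map (shapeExtend K m) (configs n)) ≡ extend K (n ℕ.+ m) 0 []
sumℤ-configs K zero    m = ℤₚ.+-identityʳ _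
sumℤ-configs K (suc n) m = begin
  sumℤ (map (shapeExtend K m) (configs (suc n)))
    ≡⟨ sumℤ-concatMap (shapeExtend K m) _ (shapeExtend K (suc m))
         (λ { (G , P) → shapeExtend-step K m (suc n) G P }) (configs n) ⟩
  sumℤ (map (shapeExtend K (suc m)) (configs n))     ≡⟨ sumℤ-configs K n (suc m) ⟩
  extend K (n ℕ.+ suc m) 0 []                 ≡⟨ cong (λ z → extend K z 0 []) (ℕₚ.+-suc n m) ⟩
  extend K (suc n ℕ.+ m) 0 []                 ∎

extend-suc-g : ∀ {K : Weight} γ → (∀ g l → K (suc g) l ≡ γ * K g l) →
  ∀ n g l → extend K n (suc g) l ≡ γ * extend K n g l
extend-suc-g γ K-suc zero    g l = K-suc g l
extend-suc-g {K} γ K-suc (suc n) g l = begin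
  extend K n (suc (suc g)) l + extend K n (suc g) (1 ∷ l) + sumℤ (map (extend K n (suc g)) (incrementEach l))
    ≡⟨ cong₂ _+_ (cong₂ _+_ (extend-suc-g γ K-suc n (suc g) l) (extend-suc-g γ K-suc n g (1 ∷ l)))
         (trans (cong sumℤ (Listₚ.map-cong (extend-suc-g γ K-suc n g) (incrementEach l)))
                (sumℤ-*ˡ γ (extend K n g) (incrementEach l))) ⟩
  γ * a + γ * b + γ * c ≡⟨ cong (_+ γ * c) (ℤₚ.*-distribˡ-+ γ a b) ⟨
  γ * (a + b) + γ * c   ≡⟨ ℤₚ.*-distribˡ-+ γ (a + b) c ⟨
  γ * (a + b + c)       ∎
  where
  a b c : ℤ
  a = extend K n (suc g) l
  b = extend K n g (1 ∷ l)
  c = sumℤ (map (extend K n g) (incrementEach l))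

extend-zero : ∀ n g l → extend (λ _ _ → + 0) n g l ≡ + 0
extend-zero zero    g l = refl
extend-zero (suc n) g l =
  trans (cong₂ _+_ (cong₂ _+_ (extend-zero n (suc g) l) (extend-zero n g (1 ∷ l)))
                   (trans (cong sumℤ (Listₚ.map-cong (extend-zero n g) (incrementEach l)))
                          (sumℤ-zeros (incrementEach l))))
        refl

-- A block of size s meets n further elements, each of which either joins it or
-- is passed on; h i weighs the outcome in which i elements were passed on.
absorb : (ℕ → ℤ) → ℕ → ℕ → (ℕ → ℤ) → ℤ
absorb f zero    s h = f s * h 0
absorb f (suc n) s h = absorb f n s (h ∘ suc) + absorb f n (suc s) h

module _ (f : ℕ → ℤ) where

  absorb-cong : ∀ {h h' : ℕ → ℤ} n s → (∀ i → h i ≡ h' i) → absorb f n s h ≡ absorb f n s h'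
  absorb-cong zero    s eq = cong (f s *_) (eq 0)
  absorb-cong (suc n) s eq = cong₂ _+_ (absorb-cong n s (eq ∘ suc)) (absorb-cong n (suc s) eq)

  absorb-zero : ∀ n s → absorb f n s (λ _ → + 0) ≡ + 0
  absorb-zero zero    s = ℤₚ.*-zeroʳ (f s)
  absorb-zero (suc n) s = cong₂ _+_ (absorb-zero n s) (absorb-zero n (suc s))

  absorb-+ : ∀ (h h' : ℕ → ℤ) n s → absorb f n s (λ i → h i + h' i) ≡ absorb f n s h + absorb f n s h'
  absorb-+ h h' zero    s = ℤₚ.*-distribˡ-+ (f s) (h 0) (h' 0)
  absorb-+ h h' (suc n) s =
    trans (cong₂ _+_ (absorb-+ (h ∘ suc) (h' ∘ suc) n s) (absorb-+ h h' n (suc s)))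
          (+-Props.interchange (absorb f n s (h ∘ suc)) (absorb f n s (h' ∘ suc)) _ _)

  absorb-sumℤ : ∀ {A : Set} (H : A → ℕ → ℤ) xs n s →
    absorb f n s (λ i → sumℤ (map (λ x → H x i) xs)) ≡ sumℤ (map (λ x → absorb f n s (H x)) xs)
  absorb-sumℤ H []       n s = absorb-zero n s
  absorb-sumℤ H (x ∷ xs) n s =
    trans (absorb-+ (H x) (λ i → sumℤ (map (λ y → H y i) xs)) n s)
          (cong (_+_ (absorb f n s (H x))) (absorb-sumℤ H xs n s))

  absorb-point : ∀ {h : ℕ → ℤ} → (∀ i → h (suc i) ≡ + 0) → ∀ n s → absorb f n s h ≡ f (s ℕ.+ n) * h 0
  absorb-point {h} h0 zero    s = cong (λ t → f t * h 0) (sym (ℕₚ.+-identityʳ s))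
  absorb-point {h} h0 (suc n) s = begin
    absorb f n s (h ∘ suc) + absorb f n (suc s) h
      ≡⟨ cong₂ _+_ (trans (absorb-cong n s h0) (absorb-zero n s)) (absorb-point h0 n (suc s)) ⟩
    + 0 + f (suc s ℕ.+ n) * h 0  ≡⟨ ℤₚ.+-identityˡ _ ⟩
    f (suc s ℕ.+ n) * h 0        ≡⟨ cong (λ t → f t * h 0) (ℕₚ.+-suc s n) ⟨
    f (s ℕ.+ suc n) * h 0        ∎

  binomialTail-shift : ∀ n s (h : ℕ → ℤ) →
    sumBelow (λ i → + (n C suc i) * h (suc i) * f (s ℕ.+ (n ∸ i))) (suc n)
      ≡ sumBelow (λ i → + (n C suc i) * h (suc i) * f (suc s ℕ.+ (n ∸ suc i))) n
  binomialTail-shift n s h = begin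
    sumBelow term (suc n)        ≡⟨ sumBelow-last term n ⟩
    sumBelow term n + term n     ≡⟨ cong (λ c → sumBelow term n + + c * h (suc n) * f (s ℕ.+ (n ∸ n)))
                                      (k>n⇒nCk≡0 (ℕₚ.n<1+n n)) ⟩
    sumBelow term n + + 0        ≡⟨ ℤₚ.+-identityʳ _ ⟩
    sumBelow term n              ≡⟨ sumBelow-cong n (λ i i<n →
                                      cong (λ t → + (n C suc i) * h (suc i) * f t) (+-∸-shift s i<n)) ⟩
    sumBelow (λ i → + (n C suc i) * h (suc i) * f (suc s ℕ.+ (n ∸ suc i))) n ∎
    where
    term : ℕ → ℤ
    term i = + (n C suc i) * h (suc i) * f (s ℕ.+ (n ∸ i))

  sumBelow-pascal : ∀ n s (h : ℕ → ℤ) →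
    sumBelow (λ i → + (suc n C suc i) * h (suc i) * f (s ℕ.+ (n ∸ i))) (suc n)
      ≡ sumBelow (λ i → + (n C i) * h (suc i) * f (s ℕ.+ (n ∸ i))) (suc n)
        + sumBelow (λ i → + (n C suc i) * h (suc i) * f (s ℕ.+ (n ∸ i))) (suc n)
  sumBelow-pascal n s h =
    trans (sumBelow-cong (suc n) (λ i _ → pascal-term n i (h (suc i)) (f (s ℕ.+ (n ∸ i)))))
          (sumBelow-+ (λ i → + (n C i) * h (suc i) * f (s ℕ.+ (n ∸ i)))
                      (λ i → + (n C suc i) * h (suc i) * f (s ℕ.+ (n ∸ i))) (suc n))

  absorb-binomial : ∀ n s (h : ℕ → ℤ) →
    absorb f n s h ≡ sumBelow (λ i → + (n C i) * h i * f (s ℕ.+ (n ∸ i))) (suc n)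
  absorb-binomial zero    s h = begin
    f s * h 0                      ≡⟨ ℤₚ.*-comm (f s) (h 0) ⟩
    h 0 * f s                      ≡⟨ cong (λ t → h 0 * f t) (ℕₚ.+-identityʳ s) ⟨
    h 0 * f (s ℕ.+ 0)       ≡⟨ cong (_* f (s ℕ.+ 0)) (ℤₚ.*-identityˡ (h 0)) ⟨
    + 1 * h 0 * f (s ℕ.+ 0) ≡⟨ ℤₚ.+-identityʳ _ ⟨
    + 1 * h 0 * f (s ℕ.+ 0) + + 0 ∎
  absorb-binomial (suc n) s h = begin
    absorb f n s (h ∘ suc) + absorb f n (suc s) h
      ≡⟨ cong₂ _+_ (absorb-binomial n s (h ∘ suc)) (absorb-binomial n (suc s) h) ⟩
    onward + (joinHead + joinTail)   ≡⟨ cong (λ t → onward + (joinHead + t)) (binomialTail-shift n s h) ⟨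
    onward + (joinHead + joinTail′)  ≡⟨ +-Props.x∙yz≈y∙xz onward joinHead joinTail′ ⟩
    joinHead + (onward + joinTail′)
      ≡⟨ cong₂ _+_ (cong (λ t → + 1 * h 0 * f t) (ℕₚ.+-suc s n)) (sumBelow-pascal n s h) ⟨
    sumBelow (λ i → + (suc n C i) * h i * f (s ℕ.+ (suc n ∸ i))) (suc (suc n)) ∎
    where
    onward joinHead joinTail joinTail′ : ℤ
    onward    = sumBelow (λ i → + (n C i) * h (suc i) * f (s ℕ.+ (n ∸ i))) (suc n)
    joinHead  = + 1 * h 0 * f (suc s ℕ.+ n)
    joinTail  = sumBelow (λ i → + (n C suc i) * h (suc i) * f (suc s ℕ.+ (n ∸ suc i))) n
    joinTail′ = sumBelow (λ i → + (n C suc i) * h (suc i) * f (s ℕ.+ (n ∸ i))) (suc n)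

incrementEach-∷ʳ : ∀ l s → incrementEach (l ∷ʳ s) ≡ map (_∷ʳ s) (incrementEach l) ∷ʳ (l ∷ʳ suc s)
incrementEach-∷ʳ []      s = refl
incrementEach-∷ʳ (a ∷ l) s = cong (_∷_ (suc a ∷ l ∷ʳ s)) (begin
  map (a ∷_) (incrementEach (l ∷ʳ s))
    ≡⟨ cong (map (a ∷_)) (incrementEach-∷ʳ l s) ⟩
  map (a ∷_) (map (_∷ʳ s) (incrementEach l) ∷ʳ (l ∷ʳ suc s))
    ≡⟨ Listₚ.map-++ (a ∷_) (map (_∷ʳ s) (incrementEach l)) _ ⟩
  map (a ∷_) (map (_∷ʳ s) (incrementEach l)) ∷ʳ (a ∷ l ∷ʳ suc s)
    ≡⟨ cong (_∷ʳ (a ∷ l ∷ʳ suc s)) (trans (sym (Listₚ.map-∘ (incrementEach l))) (Listₚ.map-∘ (incrementEach l))) ⟩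
  map (_∷ʳ s) (map (a ∷_) (incrementEach l)) ∷ʳ (a ∷ l ∷ʳ suc s) ∎)

module _ {K K' : Weight} (f : ℕ → ℤ) (K-∷ʳ : ∀ g l s → K g (l ∷ʳ s) ≡ f s * K' g l) where

  extend-∷ʳ : ∀ n g l s → extend K n g (l ∷ʳ s) ≡ absorb f n s (λ i → extend K' i g l)
  extend-∷ʳ zero    g l s = K-∷ʳ g l s
  extend-∷ʳ (suc n) g l s = begin
    extend K n (suc g) (l ∷ʳ s) + extend K n g ((1 ∷ l) ∷ʳ s)
      + sumℤ (map (extend K n g) (incrementEach (l ∷ʳ s)))
      ≡⟨ cong₂ _+_ (cong₂ _+_ (extend-∷ʳ n (suc g) l s) (extend-∷ʳ n g (1 ∷ l) s)) grown ⟩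
    absorb f n s X + absorb f n s Y + (sumℤ (map (λ μ → absorb f n s (Z μ)) (incrementEach l)) + absorb f n (suc s) W)
      ≡⟨ ℤₚ.+-assoc (absorb f n s X + absorb f n s Y) _ (absorb f n (suc s) W) ⟨
    absorb f n s X + absorb f n s Y + sumℤ (map (λ μ → absorb f n s (Z μ)) (incrementEach l)) + absorb f n (suc s) W
      ≡⟨ cong (_+ absorb f n (suc s) W) linear ⟨
    absorb f n s (W ∘ suc) + absorb f n (suc s) W ∎
    where
    W X Y : ℕ → ℤ
    W i = extend K' i g l
    X i = extend K' i (suc g) l
    Y i = extend K' i g (1 ∷ l)
    Z : List ℕ → ℕ → ℤ
    Z μ i = extend K' i g μ
    linear : absorb f n s (W ∘ suc)
           ≡ absorb f n s X + absorb f n s Y + sumℤ (map (λ μ → absorb f n s (Z μ)) (incrementEach l))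
    linear = trans (absorb-+ f (λ i → X i + Y i) (λ i → sumℤ (map (λ μ → Z μ i) (incrementEach l))) n s)
                   (cong₂ _+_ (absorb-+ f X Y n s) (absorb-sumℤ f Z (incrementEach l) n s))
    grown : sumℤ (map (extend K n g) (incrementEach (l ∷ʳ s)))
          ≡ sumℤ (map (λ μ → absorb f n s (Z μ)) (incrementEach l)) + absorb f n (suc s) W
    grown = begin
      sumℤ (map (extend K n g) (incrementEach (l ∷ʳ s)))
        ≡⟨ cong (sumℤ ∘ map (extend K n g)) (incrementEach-∷ʳ l s) ⟩
      sumℤ (map (extend K n g) (map (_∷ʳ s) (incrementEach l) ∷ʳ (l ∷ʳ suc s)))
        ≡⟨ cong sumℤ (Listₚ.map-++ (extend K n g) (map (_∷ʳ s) (incrementEach l)) _) ⟩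
      sumℤ (map (extend K n g) (map (_∷ʳ s) (incrementEach l)) ∷ʳ extend K n g (l ∷ʳ suc s))
        ≡⟨ sumℤ-∷ʳ (map (extend K n g) (map (_∷ʳ s) (incrementEach l))) _ ⟩
      sumℤ (map (extend K n g) (map (_∷ʳ s) (incrementEach l))) + extend K n g (l ∷ʳ suc s)
        ≡⟨ cong₂ _+_ (cong sumℤ (trans (sym (Listₚ.map-∘ (incrementEach l)))
                                       (Listₚ.map-cong (λ μ → extend-∷ʳ n g μ s) (incrementEach l))))
                     (extend-∷ʳ n g l (suc s)) ⟩
      sumℤ (map (λ μ → absorb f n s (Z μ)) (incrementEach l)) + absorb f n (suc s) W ∎

extend-first : ∀ {K K' : Weight} γ f → (∀ g l → K (suc g) l ≡ γ * K g l) →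
  (∀ g l s → K g (l ∷ʳ s) ≡ f s * K' g l) →
  ∀ n → extend K (suc n) 0 [] ≡ γ * extend K n 0 [] + absorb f n 1 (λ i → extend K' i 0 [])
extend-first γ f K-suc K-∷ʳ n =
  trans (ℤₚ.+-identityʳ _) (cong₂ _+_ (extend-suc-g γ K-suc n 0 []) (extend-∷ʳ f K-∷ʳ n 0 [] 1))

blocksWeight : (ℕ → ℤ) → ℕ → List ℕ → ℤ
blocksWeight f zero    []      = + 1
blocksWeight f zero    (_ ∷ _) = + 0
blocksWeight f (suc k) []      = + 0
blocksWeight f (suc k) (s ∷ l) = f s * blocksWeight f k l

shapeWeight : ℤ → (ℕ → ℤ) → ℕ → Weight
shapeWeight γ f k g l = γ ^ g * blocksWeight f k l

sizeWeight : ℤ → ℤ → ℕ → ℕ → ℤ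
sizeWeight α β ℓ s with s ≤? ℓ
... | yes _ = dff (β - α) (s ∸ 1) α
... | no  _ = + 1

blockWeight-size : ∀ α β ℓ B → blockWeight α β ℓ B ≡ sizeWeight α β ℓ (length B)
blockWeight-size α β ℓ B with length B ≤? ℓ
... | yes _ = refl
... | no  _ = refl

blocksWeight-∷ʳ : ∀ f k l s → blocksWeight f (suc k) (l ∷ʳ s) ≡ f s * blocksWeight f k l
blocksWeight-∷ʳ f k       []           s = refl
blocksWeight-∷ʳ f zero    (a ∷ [])     s = trans (ℤₚ.*-zeroʳ (f a)) (sym (ℤₚ.*-zeroʳ (f s)))
blocksWeight-∷ʳ f zero    (a ∷ b ∷ l)  s = trans (ℤₚ.*-zeroʳ (f a)) (sym (ℤₚ.*-zeroʳ (f s)))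
blocksWeight-∷ʳ f (suc k) (a ∷ l)      s =
  trans (cong (f a *_) (blocksWeight-∷ʳ f k l s)) (*-Props.x∙yz≈y∙xz (f a) (f s) _)

⌊suc≟suc⌋ : ∀ a b → ⌊ suc a ≟ suc b ⌋ ≡ ⌊ a ≟ b ⌋
⌊suc≟suc⌋ a b with a ≟ b | suc a ≟ suc b
... | yes _   | yes _     = refl
... | no  _   | no  _     = refl
... | yes a≡b | no  a+≢b+ = contradiction (cong suc a≡b) a+≢b+
... | no  a≢b | yes a+≡b+ = contradiction (ℕₚ.suc-injective a+≡b+) a≢b

blocksWeight-sizes : ∀ α β ℓ k P →
  blocksWeight (sizeWeight α β ℓ) k (map length P)
    ≡ (if ⌊ length P ≟ k ⌋ then prodℤ (map (blockWeight α β ℓ) P) else + 0)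
blocksWeight-sizes α β ℓ zero    []      = refl
blocksWeight-sizes α β ℓ zero    (B ∷ P) = refl
blocksWeight-sizes α β ℓ (suc k) []      = refl
blocksWeight-sizes α β ℓ (suc k) (B ∷ P) =
  trans (cong₂ _*_ (sym (blockWeight-size α β ℓ B)) (blocksWeight-sizes α β ℓ k P))
        (trans (*-if-zero (blockWeight α β ℓ B) ⌊ length P ≟ k ⌋ _)
               (cong (λ b → if b then prodℤ (map (blockWeight α β ℓ) (B ∷ P)) else + 0)
                     (sym (⌊suc≟suc⌋ (length P) k))))

shapeWeight-suc : ∀ γ f k g l → shapeWeight γ f k (suc g) l ≡ γ * shapeWeight γ f k g l
shapeWeight-suc γ f k g l = ℤₚ.*-assoc γ (γ ^ g) _

shapeWeight-∷ʳ : ∀ γ f k g l s → shapeWeight γ f (suc k) g (l ∷ʳ s) ≡ f s * shapeWeight γ f k g l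
shapeWeight-∷ʳ γ f k g l s =
  trans (cong (γ ^ g *_) (blocksWeight-∷ʳ f k l s)) (*-Props.x∙yz≈y∙xz (γ ^ g) (f s) _)

shapeWeight-zero-∷ʳ : ∀ γ f g l s → shapeWeight γ f zero g (l ∷ʳ s) ≡ f s * + 0
shapeWeight-zero-∷ʳ γ f g []      s = trans (ℤₚ.*-zeroʳ (γ ^ g)) (sym (ℤₚ.*-zeroʳ (f s)))
shapeWeight-zero-∷ʳ γ f g (a ∷ l) s = trans (ℤₚ.*-zeroʳ (γ ^ g)) (sym (ℤₚ.*-zeroʳ (f s)))

S≡extend : ∀ γ α β m k ℓ → S γ α β m k ℓ ≡ extend (shapeWeight γ (sizeWeight α β ℓ) k) m 0 []
S≡extend γ α β m k ℓ = begin
  S γ α β m k ℓ                              ≡⟨ sumℤ-filterᵇ _ (weight γ α β ℓ) (configs m) ⟩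
  sumℤ (map _ (configs m))                   ≡⟨ cong sumℤ (Listₚ.map-cong byShape (configs m)) ⟩
  sumℤ (map (shapeExtend K 0) (configs m))   ≡⟨ sumℤ-configs K m 0 ⟩
  extend K (m ℕ.+ 0) 0 []             ≡⟨ cong (λ z → extend K z 0 []) (ℕₚ.+-identityʳ m) ⟩
  extend K m 0 []                            ∎
  where
  K : Weight
  K = shapeWeight γ (sizeWeight α β ℓ) k
  byShape : ∀ (c : Config) →
    (if ⌊ length (proj₂ c) ≟ k ⌋ then weight γ α β ℓ c else + 0) ≡ shapeExtend K 0 c
  byShape (G , P) = sym (trans (cong (γ ^ length G *_) (blocksWeight-sizes α β ℓ k P))
                               (*-if-zero (γ ^ length G) ⌊ length P ≟ k ⌋ _))

extend-no-blocks : ∀ f i → extend (shapeWeight (+ 0) f zero) (suc i) 0 [] ≡ + 0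
extend-no-blocks f i = begin
  extend (shapeWeight (+ 0) f zero) (suc i) 0 []
    ≡⟨ extend-first (+ 0) f (shapeWeight-suc (+ 0) f zero) (shapeWeight-zero-∷ʳ (+ 0) f) i ⟩
  + 0 + absorb f i 1 (λ j → extend (λ _ _ → + 0) j 0 [])
    ≡⟨ ℤₚ.+-identityˡ _ ⟩
  absorb f i 1 (λ j → extend (λ _ _ → + 0) j 0 [])
    ≡⟨ absorb-cong f i 1 (λ j → extend-zero j 0 []) ⟩
  absorb f i 1 (λ _ → + 0)  ≡⟨ absorb-zero f i 1 ⟩
  + 0                       ∎

S-zero-one : ∀ α β ℓ j → S (+ 0) α β (suc j) 1 ℓ ≡ sizeWeight α β ℓ (suc j)
S-zero-one α β ℓ j = begin
  S (+ 0) α β (suc j) 1 ℓ                     ≡⟨ S≡extend (+ 0) α β (suc j) 1 ℓ ⟩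
  extend (shapeWeight (+ 0) f 1) (suc j) 0 []
    ≡⟨ extend-first (+ 0) f (shapeWeight-suc (+ 0) f 1) (shapeWeight-∷ʳ (+ 0) f zero) j ⟩
  + 0 + absorb f j 1 (λ i → extend (shapeWeight (+ 0) f zero) i 0 [])
    ≡⟨ ℤₚ.+-identityˡ _ ⟩
  absorb f j 1 (λ i → extend (shapeWeight (+ 0) f zero) i 0 [])
    ≡⟨ absorb-point f (extend-no-blocks f) j 1 ⟩
  f (suc j) * (+ 1 * + 1)                     ≡⟨ ℤₚ.*-identityʳ (f (suc j)) ⟩
  f (suc j)                                   ∎
  where
  f : ℕ → ℤ
  f = sizeWeight α β ℓ

mainTheorem8 : (α γ β k ℓ n : ℕ) → 1 ≤ β → 1 ≤ k → 1 ≤ ℓ → k Data.Nat.* ℓ ≤ n →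
    S (+ γ) (+ α) (+ β) (suc n) k ℓ
      ≡ (+ γ) * S (+ γ) (+ α) (+ β) n k ℓ
        + sumℤ (map (λ i → (+ (n C i)) * S (+ γ) (+ α) (+ β) i (k ∸ 1) ℓ
                             * S (+ 0) (+ α) (+ β) (suc (n ∸ i)) 1 ℓ)
                    (upTo (suc n)))
mainTheorem8 α γ β (suc k) ℓ n _ _ _ _ = begin
  S (+ γ) (+ α) (+ β) (suc n) (suc k) ℓ       ≡⟨ S≡extend (+ γ) (+ α) (+ β) (suc n) (suc k) ℓ ⟩
  extend (K (suc k)) (suc n) 0 []
    ≡⟨ extend-first (+ γ) f (shapeWeight-suc (+ γ) f (suc k)) (shapeWeight-∷ʳ (+ γ) f k) n ⟩
  + γ * extend (K (suc k)) n 0 [] + absorb f n 1 (λ i → extend (K k) i 0 [])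
    ≡⟨ cong₂ _+_ (cong (+ γ *_) (sym (S≡extend (+ γ) (+ α) (+ β) n (suc k) ℓ)))
                 (absorb-binomial f n 1 (λ i → extend (K k) i 0 [])) ⟩
  + γ * S (+ γ) (+ α) (+ β) n (suc k) ℓ
    + sumBelow (λ i → + (n C i) * extend (K k) i 0 [] * f (suc (n ∸ i))) (suc n)
    ≡⟨ cong (_+_ (+ γ * S (+ γ) (+ α) (+ β) n (suc k) ℓ)) (sym (trans (sumℤ-upTo summand (suc n))
         (sumBelow-cong (suc n) (λ i _ → cong₂ (λ a b → + (n C i) * a * b)
           (S≡extend (+ γ) (+ α) (+ β) i k ℓ) (S-zero-one (+ α) (+ β) ℓ (n ∸ i)))))) ⟩
  + γ * S (+ γ) (+ α) (+ β) n (suc k) ℓ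
    + sumℤ (map summand (upTo (suc n))) ∎
  where
  f : ℕ → ℤ
  f = sizeWeight (+ α) (+ β) ℓ
  K : ℕ → Weight
  K = shapeWeight (+ γ) f
  summand : ℕ → ℤ
  summand i = + (n C i) * S (+ γ) (+ α) (+ β) i k ℓ * S (+ 0) (+ α) (+ β) (suc (n ∸ i)) 1 ℓ
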